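{- For every integer $n\ge 1$, let $G_n$ be the graph of $V$'s in the complete binary tree $T_n$ (defined in the context). Then the path-chromatic number of $G_n$ is at most $2$, i.e. $\operatorname{pchr}(G_n)\le 2$.
   Context: The complete binary tree $T_n$ has as vertices all binary strings of length at most $n$ (including the empty string, the root); as a graph, $x$ is adjacent to $x0$ and $x1$. Write $x<y$ if $x$ is a proper initial segment of $y$. A $V$ in $T_n$ is a path in $T_n$ between two distinct vertices $y,z$ such that the vertex of the path closest to the root lies strictly between $y$ and $z$ on the path; this vertex $x$ is the low point of the $V$. Equivalently, a $V$ is determined by a triple $(x,y,z)$ of strings with $x0$ an initial segment of $y$ and $x1$ an initial segment of $z$; its endpoints are $y,z$ and its low point is $x$. The graph $G_n$ has as vertex set all $V$'s in $T_n$, two $V$'s being adjacent when an endpoint of one of them is the low point of the other. A path-decomposition of a graph $G$ is a path $P$ together with subsets (bags) $B_t\subseteq V(G)$, $t\in V(P)$, such that every vertex of $G$ lies in some bag, both ends of every edge lie together in some bag, and for each vertex $v$ of $G$ the set of $t$ with $v\in B_t$ induces a connected subpath of $P$. The chromatic number of a path-decomposition is the maximum over $t$ of the chromatic number of the subgraph of $G$ induced by $B_t$; the path-chromatic number $\operatorname{pchr}(G)$ is the minimum chromatic number of a path-decomposition of $G$. -}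

module Defs where

open import Data.Nat using (ℕ; _≤_; _<_; suc)
open import Data.Bool using (Bool; true; false)
open import Data.List using (List; _∷_; _++_; length)
open import Data.Fin using (Fin; _≤_)
open import Data.Product using (Σ; ∃; _×_; _,_)
open import Data.Sum using (_⊎_)
open import Relation.Binary.PropositionalEquality using (_≡_; _≢_)

-- Binary strings are lists of booleans (false = 0, true = 1).
-- A V in T_n: a triple (x,y,z) with x0 an initial segment of y and
-- x1 an initial segment of z, where y,z have length at most n.
-- We record y = x ++ 0 ∷ u and z = x ++ 1 ∷ v.
record V (n : ℕ) : Set where
  constructor mkV
  field
    low  : List Bool
    tail₀ : List Bool
    tail₁ : List Bool
    len₀ : length (low ++ false ∷ tail₀) Data.Nat.≤ n
    len₁ : length (low ++ true ∷ tail₁) Data.Nat.≤ n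

  end₀ : List Bool
  end₀ = low ++ false ∷ tail₀

  end₁ : List Bool
  end₁ = low ++ true ∷ tail₁

open V public

IsEndpoint : ∀ {n} → List Bool → V n → Set
IsEndpoint s a = (s ≡ end₀ a) ⊎ (s ≡ end₁ a)

Adj : ∀ {n} → V n → V n → Set
Adj a b = IsEndpoint (low b) a ⊎ IsEndpoint (low a) b

-- A path-decomposition of G_n whose path P has m vertices 0,1,…,m-1
-- (in path order); bag membership is given by B t a ≡ true.
record PathDecomposition (n : ℕ) : Set where
  field
    m     : ℕ
    B     : Fin m → V n → Bool
    cover : ∀ (a : V n) → ∃ λ t → B t a ≡ true
    edge  : ∀ (a b : V n) → Adj a b → ∃ λ t → (B t a ≡ true) × (B t b ≡ true)
    conn  : ∀ (a : V n) (i j k : Fin m) → i Data.Fin.≤ j → j Data.Fin.≤ k →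
            B i a ≡ true → B k a ≡ true → B j a ≡ true

open PathDecomposition public

BagColourable : ∀ {n} → PathDecomposition n → ℕ → Set
BagColourable {n} D k =
  ∀ (t : Fin (m D)) → Σ (V n → Fin k) λ c →
    ∀ (a b : V n) → B D t a ≡ true → B D t b ≡ true → Adj a b → c a ≢ c b

PchrAtMost : ℕ → ℕ → Set
PchrAtMost n k = Σ (PathDecomposition n) λ D → BagColourable D k

module Submission where

open import Defs
open import Data.Nat using (ℕ; _≤_)
open import Data.Nat using (zero; suc; _+_; _^_; _<_; s≤s; _≤?_; _<?_)
open import Data.Nat.Properties
  using (+-identityʳ; m^n>0; <-≤-trans; ≤-<-trans; <-trans; ≤-trans; ≤-refl; ≤-reflexive;
         m≤m+n; m<m+n; +-monoʳ-<; <⇒≤; <⇒≱)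
open import Data.Bool using (Bool; true; false)
open import Data.List using (List; []; _∷_; _++_; length)
open import Data.List.Properties using (++-assoc)
open import Data.Fin using (Fin; toℕ; fromℕ<)
open import Data.Fin.Properties using (toℕ-fromℕ<; 0≢1+n)
open import Data.Product using (∃; _×_; _,_; proj₁; proj₂)
open import Data.Sum using (inj₁; inj₂)
open import Relation.Nullary using (Dec; yes; no; does; _×-dec_; contradiction)
open import Relation.Nullary.Decidable using (dec-true)
open import Relation.Binary.PropositionalEquality

-- Number the vertices of T_n in in-order (left subtree, root, right subtree).
-- A V (x, y, z) then satisfies y < x < z, and it is put in the bags of the
-- positions t with y ≤ t < z, coloured 0 when t < x and 1 otherwise.  If a V
-- b hangs from the left endpoint y of a V a, then the whole interval of b lies
-- in [y, x), where a gets colour 0 and b, whose low point is y, gets colour 1;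
-- symmetrically at the right endpoint.

private
  variable
    A : Set
    k lo hi t x x′ : ℕ

dec-true⁻¹ : (a? : Dec A) → does a? ≡ true → A
dec-true⁻¹ (yes a) _ = a

-- Positions in T_k run over 1 … 2 ^ (k + 1) − 1; strings longer than k get the junk value 0.
inorder : ℕ → List Bool → ℕ
inorder k       []          = 2 ^ k
inorder zero    (_ ∷ _)     = 0
inorder (suc k) (false ∷ s) = inorder k s
inorder (suc k) (true ∷ s)  = 2 ^ suc k + inorder k s

2^suc≡2^+2^ : ∀ k → 2 ^ suc k ≡ 2 ^ k + 2 ^ k
2^suc≡2^+2^ k = cong (2 ^ k +_) (+-identityʳ (2 ^ k))

inorder>0 : ∀ s → length s ≤ k → 0 < inorder k s
inorder>0 {k}     []          _       = m^n>0 2 k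
inorder>0 {suc k} (false ∷ s) (s≤s l) = inorder>0 s l
inorder>0 {suc k} (true ∷ s)  (s≤s l) = <-≤-trans (m^n>0 2 (suc k)) (m≤m+n _ _)

inorder<2^suc : ∀ s → length s ≤ k → inorder k s < 2 ^ suc k
inorder<2^suc {k} [] _ =
  subst (2 ^ k <_) (sym (2^suc≡2^+2^ k)) (m<m+n (2 ^ k) (m^n>0 2 k))
inorder<2^suc {suc k} (false ∷ s) (s≤s l) =
  <-≤-trans (inorder<2^suc s l) (m≤m+n _ _)
inorder<2^suc {suc k} (true ∷ s) (s≤s l) =
  subst (2 ^ suc k + inorder k s <_) (sym (2^suc≡2^+2^ (suc k)))
    (+-monoʳ-< (2 ^ suc k) (inorder<2^suc s l))

inorder-left : ∀ x u → length (x ++ false ∷ u) ≤ k → inorder k (x ++ false ∷ u) < inorder k x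
inorder-left {suc k} []          u (s≤s l) = inorder<2^suc u l
inorder-left {suc k} (false ∷ x) u (s≤s l) = inorder-left x u l
inorder-left {suc k} (true ∷ x)  u (s≤s l) = +-monoʳ-< (2 ^ suc k) (inorder-left x u l)

inorder-right : ∀ x u → length (x ++ true ∷ u) ≤ k → inorder k x < inorder k (x ++ true ∷ u)
inorder-right {suc k} []          u (s≤s l) = m<m+n (2 ^ suc k) (inorder>0 u l)
inorder-right {suc k} (false ∷ x) u (s≤s l) = inorder-right x u l
inorder-right {suc k} (true ∷ x)  u (s≤s l) = +-monoʳ-< (2 ^ suc k) (inorder-right x u l)

_∈ᵇ[_,_⟩ : ℕ → ℕ → ℕ → Bool
t ∈ᵇ[ lo , hi ⟩ = does (lo ≤? t ×-dec t <? hi)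

∈ᵇ-intro : lo ≤ t → t < hi → t ∈ᵇ[ lo , hi ⟩ ≡ true
∈ᵇ-intro {lo} {t} {hi} p q = dec-true (lo ≤? t ×-dec t <? hi) (p , q)

∈ᵇ-elim : t ∈ᵇ[ lo , hi ⟩ ≡ true → lo ≤ t × t < hi
∈ᵇ-elim {t} {lo} {hi} = dec-true⁻¹ (lo ≤? t ×-dec t <? hi)

side : ℕ → ℕ → Fin 2
side x t with t <? x
... | yes _ = Fin.zero
... | no  _ = Fin.suc Fin.zero

side-left : t < x → side x t ≡ Fin.zero
side-left {t} {x} t<x with t <? x
... | yes _   = refl
... | no  t≮x = contradiction t<x t≮x

side-right : x ≤ t → side x t ≡ Fin.suc Fin.zero
side-right {x} {t} x≤t with t <? x
... | yes t<x = contradiction x≤t (<⇒≱ t<x)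
... | no  _   = refl

side-differs : t < x → x′ ≤ t → side x t ≢ side x′ t
side-differs t<x x′≤t e = 0≢1+n (trans (sym (side-left t<x)) (trans e (side-right x′≤t)))

module _ (n : ℕ) where

  position : List Bool → ℕ
  position = inorder n

  end₀<low : (a : V n) → position (end₀ a) < position (low a)
  end₀<low a = inorder-left (low a) (tail₀ a) (len₀ a)

  low<end₁ : (a : V n) → position (low a) < position (end₁ a)
  low<end₁ a = inorder-right (low a) (tail₁ a) (len₁ a)

  end₀<end₁ : (a : V n) → position (end₀ a) < position (end₁ a)
  end₀<end₁ a = <-trans (end₀<low a) (low<end₁ a)

  end₁<2^suc : (a : V n) → position (end₁ a) < 2 ^ suc n
  end₁<2^suc a = inorder<2^suc (end₁ a) (len₁ a)

  end₁<low-of-end₀ : (a b : V n) → low b ≡ end₀ a → position (end₁ b) < position (low a)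
  end₁<low-of-end₀ a b e =
    subst (λ w → position w < position (low a)) (sym end₁b≡)
      (inorder-left (low a) _ (subst (λ w → length w ≤ n) end₁b≡ (len₁ b)))
    where
    end₁b≡ : end₁ b ≡ low a ++ false ∷ (tail₀ a ++ true ∷ tail₁ b)
    end₁b≡ = trans (cong (_++ true ∷ tail₁ b) e) (++-assoc (low a) (false ∷ tail₀ a) (true ∷ tail₁ b))

  low<end₀-of-end₁ : (a b : V n) → low b ≡ end₁ a → position (low a) < position (end₀ b)
  low<end₀-of-end₁ a b e =
    subst (λ w → position (low a) < position w) (sym end₀b≡)
      (inorder-right (low a) _ (subst (λ w → length w ≤ n) end₀b≡ (len₀ b)))
    where
    end₀b≡ : end₀ b ≡ low a ++ true ∷ (tail₁ a ++ false ∷ tail₀ b)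
    end₀b≡ = trans (cong (_++ false ∷ tail₀ b) e) (++-assoc (low a) (true ∷ tail₁ a) (false ∷ tail₀ b))

  bag : Fin (2 ^ suc n) → V n → Bool
  bag t a = toℕ t ∈ᵇ[ position (end₀ a) , position (end₁ a) ⟩

  bag-elim : ∀ t (a : V n) → bag t a ≡ true →
             position (end₀ a) ≤ toℕ t × toℕ t < position (end₁ a)
  bag-elim t a = ∈ᵇ-elim

  shared-bag : (a b : V n) →
               position (end₀ a) ≤ t → t < position (end₁ a) →
               position (end₀ b) ≤ t → t < position (end₁ b) →
               ∃ λ i → bag i a ≡ true × bag i b ≡ true
  shared-bag {t} a b p q p′ q′ = fromℕ< t<2^suc , in-bag a p q , in-bag b p′ q′
    where
    t<2^suc : t < 2 ^ suc n
    t<2^suc = <-trans q′ (end₁<2^suc b)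

    in-bag : ∀ c → position (end₀ c) ≤ t → t < position (end₁ c) → bag (fromℕ< t<2^suc) c ≡ true
    in-bag _ r s rewrite toℕ-fromℕ< t<2^suc = ∈ᵇ-intro r s

  cover′ : (a : V n) → ∃ λ i → bag i a ≡ true
  cover′ a with shared-bag a a ≤-refl (end₀<end₁ a) ≤-refl (end₀<end₁ a)
  ... | i , in-a , _ = i , in-a

  edge-at-endpoint : (a b : V n) → IsEndpoint (low b) a → ∃ λ i → bag i a ≡ true × bag i b ≡ true
  edge-at-endpoint a b (inj₁ e) =
    shared-bag a b
      (≤-reflexive (cong position (sym e)))
      (subst (λ w → position w < position (end₁ a)) (sym e) (end₀<end₁ a))
      (<⇒≤ (end₀<low b)) (low<end₁ b)
  edge-at-endpoint a b (inj₂ e) =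
    shared-bag a b
      (<⇒≤ (<-trans (end₀<low a) (low<end₀-of-end₁ a b e)))
      (subst (λ w → position (end₀ b) < position w) e (end₀<low b))
      ≤-refl (end₀<end₁ b)

  edge′ : (a b : V n) → Adj a b → ∃ λ i → bag i a ≡ true × bag i b ≡ true
  edge′ a b (inj₁ p) = edge-at-endpoint a b p
  edge′ a b (inj₂ p) with edge-at-endpoint b a p
  ... | i , in-b , in-a = i , in-a , in-b

  conn′ : (a : V n) (i j k : Fin (2 ^ suc n)) → i Data.Fin.≤ j → j Data.Fin.≤ k →
          bag i a ≡ true → bag k a ≡ true → bag j a ≡ true
  conn′ a i j k i≤j j≤k in-i in-k =
    ∈ᵇ-intro (≤-trans (proj₁ (bag-elim i a in-i)) i≤j) (≤-<-trans j≤k (proj₂ (bag-elim k a in-k)))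

  decomposition : PathDecomposition n
  decomposition = record { m = 2 ^ suc n ; B = bag ; cover = cover′ ; edge = edge′ ; conn = conn′ }

  colour : Fin (2 ^ suc n) → V n → Fin 2
  colour t a = side (position (low a)) (toℕ t)

  colour-differs-at-endpoint : ∀ t (a b : V n) → bag t a ≡ true → bag t b ≡ true →
                               IsEndpoint (low b) a → colour t a ≢ colour t b
  colour-differs-at-endpoint t a b in-a in-b (inj₁ e) =
    side-differs
      (<-trans (proj₂ (bag-elim t b in-b)) (end₁<low-of-end₀ a b e))
      (subst (λ w → position w ≤ toℕ t) (sym e) (proj₁ (bag-elim t a in-a)))
  colour-differs-at-endpoint t a b in-a in-b (inj₂ e) same =
    side-differs
      (subst (λ w → toℕ t < position w) (sym e) (proj₂ (bag-elim t a in-a)))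
      (<⇒≤ (<-≤-trans (low<end₀-of-end₁ a b e) (proj₁ (bag-elim t b in-b))))
      (sym same)

  colourable : BagColourable decomposition 2
  colourable t = colour t , λ where
    a b in-a in-b (inj₁ p)      → colour-differs-at-endpoint t a b in-a in-b p
    a b in-a in-b (inj₂ p) same → colour-differs-at-endpoint t b a in-b in-a p (sym same)

theorem2 : (n : ℕ) → 1 ≤ n → PchrAtMost n 2
theorem2 n _ = decomposition n , colourable n
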